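{- Let $\ell\ge4$ be an integer, $f$ a slow function and $G$ the $(f,\ell)$-layered wheel with layers $L_1,L_2,\dots$. For all integers $i\ge1$ and $i'>i$, every vertex $u\in L_i$ has at least one neighbour in $L_{i'}$.
   Context: A function $f:\mathbb N\setminus\{0\}\to\mathbb N\setminus\{0\}$ is slow if $f(1)=1,f(2)=2,f(3)=3$ and $f(i)\le f(i+1)\le f(i)+1$ for all $i$. The $(f,\ell)$-layered wheel $G$ is the infinite graph (considered as an undirected simple graph; orientations only descriptive) whose vertex set is partitioned into finite layers $L_1,L_2,\dots$, built inductively. For $v\in L_i$ let $N^\uparrow(v)$ be the set of neighbours of $v$ in $L_1\cup\dots\cup L_{i-1}$ and $N^\uparrow[v]=N^\uparrow(v)\cup\{v\}$. $L_1$ induces a directed cycle of length $\ell$. Given $L_1,\dots,L_i$, for each $v\in L_i$ create a directed path $L(v)=v_1\dots v_{n_v}$ of new vertices: (a) if $|N^\uparrow(v)|<f(i+1)-1$, then $n_v=\ell-2$, $N^\uparrow(v_1)=N^\uparrow[v]$ and $N^\uparrow(v_j)=\emptyset$ for $j\ge2$; (b) if $|N^\uparrow(v)|=f(i+1)-1=:m$, write $N^\uparrow(v)=\{w_1,\dots,w_m\}$; then $n_v=m(\ell-2)$, $N^\uparrow(v_{(j-1)(\ell-2)+1})=N^\uparrow[v]\setminus\{w_j\}$ for $j=1,\dots,m$, and all other vertices of $L(v)$ have $N^\uparrow=\emptyset$ (the construction guarantees $|N^\uparrow(v)|\le f(i+1)-1$ always). Specifying $N^\uparrow(u)$ for a new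 vertex $u$ means $u$ is adjacent exactly to those vertices of earlier layers. $L_{i+1}=\bigcup_{v\in L_i}V(L(v))$ induces the directed cycle obtained from the paths $L(v)$ by adding, for every arc $vv'$ of the cycle $L_i$, the arc $v_{n_v}v'_1$. -}

module Defs where

open import Data.Nat using (ℕ; zero; suc; _∸_; _≤_; _<_; _<ᵇ_)
open import Data.Bool using (if_then_else_)
open import Data.List using (List; []; _∷_; _++_; [_]; length; replicate)
open import Data.List.Membership.Propositional using (_∈_)
open import Data.Product using (_×_; _,_)
open import Data.Sum using (_⊎_)
open import Relation.Binary.PropositionalEquality using (_≡_)

-- f : ℕ⁺ → ℕ⁺ is modelled as ℕ → ℕ; the value at 0 is irrelevant.
-- Positivity of values on ℕ⁺ follows from f 1 ≡ 1 and monotonicity.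
record Slow (f : ℕ → ℕ) : Set where
  field
    f1 : f 1 ≡ 1
    f2 : f 2 ≡ 2
    f3 : f 3 ≡ 3
    mono : ∀ i → 1 ≤ i → f i ≤ f (suc i)
    step : ∀ i → 1 ≤ i → f (suc i) ≤ suc (f i)

-- A vertex is named by (layer index i ≥ 1 , position p in the cyclic order of L_i).
Vtx : Set
Vtx = ℕ × ℕ

at : {A : Set} → A → List A → ℕ → A
at d []       _       = d
at d (x ∷ xs) zero    = x
at d (x ∷ xs) (suc n) = at d xs n

-- The (f,ℓ)-layered wheel.  'ord i p U' is the enumeration w_1,…,w_m of
-- N^↑(v) chosen for the vertex v = (i,p) in case (b) (required, in the
-- theorem, to be a permutation of U).
module Wheel (ℓ : ℕ) (f : ℕ → ℕ) (ord : ℕ → ℕ → List Vtx → List Vtx) where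

  -- Case (b): for W = w_1 … w_m, block j is ℓ-2 new vertices, the first
  -- of which has N^↑ = {v} ∪ (W without w_j), the others N^↑ = ∅.
  blocks : Vtx → List Vtx → List Vtx → List (List Vtx)
  blocks v pre []       = []
  blocks v pre (w ∷ ws) =
    ((v ∷ (pre ++ ws)) ∷ replicate (ℓ ∸ 3) []) ++ blocks v (pre ++ [ w ]) ws

  -- The path L(v) for v = (i,p) ∈ L_i with N^↑(v) = U, listed as the
  -- N^↑-lists of v_1,…,v_{n_v} in path order.
  expand : ℕ → ℕ → List Vtx → List (List Vtx)
  expand i p U =
    if length U <ᵇ (f (suc i) ∸ 1)
    then ((i , p) ∷ U) ∷ replicate (ℓ ∸ 3) []
    else blocks (i , p) [] (ord i p U)

  nextLayer : ℕ → ℕ → List (List Vtx) → List (List Vtx)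
  nextLayer i p []       = []
  nextLayer i p (U ∷ Us) = expand i p U ++ nextLayer i (suc p) Us

  -- layer i = the list, in cyclic order, of N^↑(u) for u ∈ L_i (i ≥ 1).
  layer : ℕ → List (List Vtx)
  layer zero          = []
  layer (suc zero)    = replicate ℓ []
  layer (suc (suc k)) = nextLayer (suc k) 0 (layer (suc k))

  size : ℕ → ℕ
  size i = length (layer i)

  up : Vtx → List Vtx
  up (i , p) = at [] (layer i) p

  IsVertex : Vtx → Set
  IsVertex (i , p) = 1 ≤ i × p < size i

  CycleAdj : Vtx → Vtx → Set
  CycleAdj (i , p) (j , q) =
    i ≡ j × (suc p ≡ q ⊎ suc q ≡ p
             ⊎ (suc p ≡ size i × q ≡ 0) ⊎ (suc q ≡ size i × p ≡ 0))

  Adj : Vtx → Vtx → Set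
  Adj u v = IsVertex u × IsVertex v × (u ∈ up v ⊎ v ∈ up u ⊎ CycleAdj u v)

module Submission where

open import Defs
open import Data.Nat using (ℕ; _≤_; _<_)
open import Data.List using (List)
open import Data.Product using (∃; _×_; _,_)
open import Data.List.Relation.Binary.Permutation.Propositional using (_↭_)

open import Data.Nat using (zero; suc; _+_; _∸_; _<ᵇ_; _≤′_; ≤′-refl; ≤′-step; z≤n; s≤s)
open import Data.Nat.Properties
  using (≤-trans; ≤-reflexive; ≮⇒≥; <⇒<ᵇ; ∸-monoˡ-≤; ≤⇒≤′; ≤′⇒≤; <⇒≤; +-identityʳ; +-suc)
open import Data.Bool using (true; false; T)
open import Data.List using ([]; _∷_; length; replicate)
open import Data.List.Relation.Unary.Any using (Any; here; there)
open import Data.List.Relation.Unary.Any.Properties using (++⁺ˡ; ++⁺ʳ)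
open import Data.List.Membership.Propositional using (_∈_)
open import Data.List.Relation.Binary.Permutation.Propositional using (↭-sym)
open import Data.List.Relation.Binary.Permutation.Propositional.Properties using (∈-resp-↭; ↭-length)
open import Data.Sum using (inj₁)
open import Relation.Binary.PropositionalEquality using (_≡_; refl; sym; subst)

-- The vertex u ∈ L_i lies in N^↑(v) for the first vertex v of the path L(u) ⊆ L_{i+1}.
-- Every w ∈ N^↑(v) for v ∈ L_j, j ≥ 2, lies in N^↑ of some vertex of L(v): in case (a)
-- the first vertex of L(v) sees all of N^↑[v]; in case (b) there are m = f(j+1) - 1 ≥ 2
-- blocks, and w is missing from only one of them.  So u is an up-neighbour of some
-- vertex in every later layer.

any⇒at : {A : Set} {P : A → Set} {d : A} (xs : List A) →
         Any P xs → ∃ λ q → q < length xs × P (at d xs q)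
any⇒at (x ∷ xs) (here px)  = 0 , s≤s z≤n , px
any⇒at (x ∷ xs) (there pxs) with any⇒at xs pxs
... | q , q<n , pq = suc q , s≤s q<n , pq

<ᵇ≡false⇒≥ : ∀ {m n} → (m <ᵇ n) ≡ false → n ≤ m
<ᵇ≡false⇒≥ eq = ≮⇒≥ λ m<n → subst T eq (<⇒<ᵇ m<n)

module _ {f : ℕ → ℕ} (slow : Slow f) where
  open Slow slow

  slow-mono : ∀ {i j} → 1 ≤ i → i ≤′ j → f i ≤ f j
  slow-mono 1≤i ≤′-refl        = ≤-reflexive refl
  slow-mono 1≤i (≤′-step i≤′j) =
    ≤-trans (slow-mono 1≤i i≤′j) (mono _ (≤-trans 1≤i (≤′⇒≤ i≤′j)))

  slow-≥2 : ∀ {i} → 2 ≤ i → 2 ≤ f i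
  slow-≥2 2≤i = ≤-trans (≤-reflexive (sym f2)) (slow-mono (s≤s z≤n) (≤⇒≤′ 2≤i))

  slow-≥3 : ∀ {i} → 3 ≤ i → 3 ≤ f i
  slow-≥3 3≤i = ≤-trans (≤-reflexive (sym f3)) (slow-mono (s≤s z≤n) (≤⇒≤′ 3≤i))

module _ (ℓ : ℕ) (f : ℕ → ℕ) (ord : ℕ → ℕ → List Vtx → List Vtx) where
  open Wheel ℓ f ord

  HasDownNeighbourIn : Vtx → ℕ → Set
  HasDownNeighbourIn u j = Any (u ∈_) (layer j)

  blocks-∋-centre : ∀ v pre ws → 1 ≤ length ws → Any (v ∈_) (blocks v pre ws)
  blocks-∋-centre v pre (_ ∷ _) _ = here (here refl)

  blocks-⊇ : ∀ v {u} ws → 2 ≤ length ws → u ∈ ws → Any (u ∈_) (blocks v [] ws)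
  blocks-⊇ v (_ ∷ [])     (s≤s ()) _
  -- w₁ is the one vertex missing from the first block; it lies in the second.
  blocks-⊇ v (_ ∷ _ ∷ _) _ (here u≡w) =
    there (++⁺ʳ (replicate (ℓ ∸ 3) []) (here (there (here u≡w))))
  blocks-⊇ v (_ ∷ _ ∷ _) _ (there u∈ws) = here (there u∈ws)

  module _ (perm : ∀ i p xs → ord i p xs ↭ xs) where

    length-ord-≥ : ∀ i p U → (length U <ᵇ f (suc i) ∸ 1) ≡ false →
                   f (suc i) ∸ 1 ≤ length (ord i p U)
    length-ord-≥ i p U eq = subst (_ ≤_) (sym (↭-length (perm i p U))) (<ᵇ≡false⇒≥ eq)

    expand-∋-centre : ∀ i p U → 2 ≤ f (suc i) → Any ((i , p) ∈_) (expand i p U)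
    expand-∋-centre i p U 2≤f with length U <ᵇ f (suc i) ∸ 1 in eq
    ... | true  = here (here refl)
    ... | false = blocks-∋-centre (i , p) [] (ord i p U)
                    (≤-trans (∸-monoˡ-≤ 1 2≤f) (length-ord-≥ i p U eq))

    expand-⊇ : ∀ i p {u} U → 3 ≤ f (suc i) → u ∈ U → Any (u ∈_) (expand i p U)
    expand-⊇ i p U 3≤f u∈U with length U <ᵇ f (suc i) ∸ 1 in eq
    ... | true  = here (there u∈U)
    ... | false = blocks-⊇ (i , p) (ord i p U)
                    (≤-trans (∸-monoˡ-≤ 1 3≤f) (length-ord-≥ i p U eq))
                    (∈-resp-↭ (↭-sym (perm i p U)) u∈U)

    nextLayer-∋ : ∀ i q Us k → 2 ≤ f (suc i) → k < length Us →
                  Any ((i , q + k) ∈_) (nextLayer i q Us)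
    nextLayer-∋ i q (U ∷ Us) zero 2≤f _ rewrite +-identityʳ q =
      ++⁺ˡ (expand-∋-centre i q U 2≤f)
    nextLayer-∋ i q (U ∷ Us) (suc k) 2≤f (s≤s k<n) rewrite +-suc q k =
      ++⁺ʳ (expand i q U) (nextLayer-∋ i (suc q) Us k 2≤f k<n)

    nextLayer-⊇ : ∀ i q Us {u} → 3 ≤ f (suc i) →
                  Any (u ∈_) Us → Any (u ∈_) (nextLayer i q Us)
    nextLayer-⊇ i q (U ∷ Us) 3≤f (here u∈U)   = ++⁺ˡ (expand-⊇ i q U 3≤f u∈U)
    nextLayer-⊇ i q (U ∷ Us) 3≤f (there u∈Us) =
      ++⁺ʳ (expand i q U) (nextLayer-⊇ i (suc q) Us 3≤f u∈Us)

    module _ (slow : Slow f) where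

      vertex-hasDownNeighbourIn-next : ∀ {i p} → IsVertex (i , p) →
                                       HasDownNeighbourIn (i , p) (suc i)
      vertex-hasDownNeighbourIn-next {suc i} (_ , p<n) =
        nextLayer-∋ (suc i) 0 (layer (suc i)) _ (slow-≥2 slow (s≤s (s≤s z≤n))) p<n

      hasDownNeighbourIn-suc : ∀ {u j} → 2 ≤ j →
                               HasDownNeighbourIn u j → HasDownNeighbourIn u (suc j)
      hasDownNeighbourIn-suc {j = suc zero} (s≤s ())
      hasDownNeighbourIn-suc {j = suc (suc j)} _ =
        nextLayer-⊇ (suc (suc j)) 0 (layer (suc (suc j))) (slow-≥3 slow (s≤s (s≤s (s≤s z≤n))))

      hasDownNeighbourIn-upward : ∀ {u j k} → 2 ≤ j → j ≤′ k →
                                  HasDownNeighbourIn u j → HasDownNeighbourIn u k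
      hasDownNeighbourIn-upward 2≤j ≤′-refl        h = h
      hasDownNeighbourIn-upward 2≤j (≤′-step j≤′k) h =
        hasDownNeighbourIn-suc (≤-trans 2≤j (≤′⇒≤ j≤′k)) (hasDownNeighbourIn-upward 2≤j j≤′k h)

mainTheorem6 : (ℓ : ℕ) → 4 ≤ ℓ → (f : ℕ → ℕ) → Slow f →
    (ord : ℕ → ℕ → List Vtx → List Vtx) → (∀ i p xs → ord i p xs ↭ xs) →
    ∀ i i' p → 1 ≤ i → i < i' → Wheel.IsVertex ℓ f ord (i , p) →
    ∃ λ q → q < Wheel.size ℓ f ord i' × Wheel.Adj ℓ f ord (i , p) (i' , q)
mainTheorem6 ℓ _ f slow ord perm i i' p 1≤i i<i' u∈Li =
  let down : HasDownNeighbourIn ℓ f ord (i , p) i'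
      down = hasDownNeighbourIn-upward ℓ f ord perm slow (s≤s 1≤i) (≤⇒≤′ i<i')
               (vertex-hasDownNeighbourIn-next ℓ f ord perm slow u∈Li)
      (q , q<n , u∈up) = any⇒at (Wheel.layer ℓ f ord i') down
  in q , q<n , u∈Li , (≤-trans 1≤i (<⇒≤ i<i') , q<n) , inj₁ u∈up
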